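{- Let $n \ge 2$ and let $G$ be a multigraph on $n$ vertices whose edges are colored with $n-1$ colors so that each color class is a spanning star of $G$. Then $G$ contains $n-1$ pairwise edge-disjoint rainbow spanning stars if and only if either all $n-1$ monochromatic stars have the same center or all $n-1$ monochromatic stars have pairwise different centers.
   Context: A star is a set of edges forming a tree in which one vertex (the center) is incident to every edge; it is spanning if every vertex of $G$ is incident to one of its edges (equivalently it has $n-1$ edges). A subgraph is rainbow if all its edges have distinct colors. Parallel edges are distinct edges. -}

module Defs where

open import Data.Nat using (ℕ; _∸_)
open import Data.Fin using (Fin)
open import Data.Fin.Subset using (Subset; _∈_)
open import Data.Product using (_×_; Σ; ∃; _,_; proj₁; proj₂)
open import Data.Sum using (_⊎_)
open import Relation.Binary.PropositionalEquality using (_≡_; _≢_)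
open import Relation.Nullary using (¬_)
open import Data.Empty using (⊥)

-- A multigraph on vertex set Fin n: finitely many edges (indexed by Fin m,
-- so parallel edges are distinct), each with an (unordered) pair of endpoints.
record Multigraph (n : ℕ) : Set where
  field
    m    : ℕ
    ends : Fin m → Fin n × Fin n

open Multigraph public

module _ {n : ℕ} (G : Multigraph n) where

  Incident : Fin (m G) → Fin n → Set
  Incident e v = proj₁ (ends G e) ≡ v ⊎ proj₂ (ends G e) ≡ v

  JoinsCenter : Fin (m G) → Fin n → Set
  JoinsCenter e c =
    (proj₁ (ends G e) ≡ c × proj₂ (ends G e) ≢ c) ⊎
    (proj₂ (ends G e) ≡ c × proj₁ (ends G e) ≢ c)

  -- The edge set S (given as a predicate on edges) is a spanning star with
  -- center c: every edge of S joins c to another vertex, and every vertex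
  -- v ≠ c is incident to exactly one edge of S.  (This is exactly a tree all
  -- of whose edges contain c and which covers every vertex.)
  IsSpanningStarAt : (Fin (m G) → Set) → Fin n → Set
  IsSpanningStarAt S c =
    (∀ e → S e → JoinsCenter e c) ×
    (∀ v → v ≢ c →
       (Σ (Fin (m G)) λ e → S e × Incident e v) ×
       (∀ e e′ → S e → S e′ → Incident e v → Incident e′ v → e ≡ e′))

  IsSpanningStar : (Fin (m G) → Set) → Set
  IsSpanningStar S = ∃ λ c → IsSpanningStarAt S c

  module _ (col : Fin (m G) → Fin (n ∸ 1)) where

    ColorClass : Fin (n ∸ 1) → Fin (m G) → Set
    ColorClass i e = col e ≡ i

    Rainbow : Subset (m G) → Set
    Rainbow S = ∀ e e′ → e ∈ S → e′ ∈ S → col e ≡ col e′ → e ≡ e′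

    RainbowSpanningStar : Subset (m G) → Set
    RainbowSpanningStar S = IsSpanningStar (_∈ S) × Rainbow S

    HasDisjointRainbowStars : Set
    HasDisjointRainbowStars =
      Σ (Fin (n ∸ 1) → Subset (m G)) λ T →
        (∀ i → RainbowSpanningStar (T i)) ×
        (∀ i j → i ≢ j → ∀ e → e ∈ T i → e ∈ T j → ⊥)

-- A rainbow spanning star has an edge at each of the N = n − 1 vertices other than its centre, all of
-- different colours, so it contains every colour.  If colours i ≠ i′ share a centre u, every rainbow
-- spanning star is therefore centred at u (otherwise its edges of colours i and i′ would both cover u),
-- so all of them contain the unique edge at u of any colour j whose centre is not u.
-- Conversely, an edge is determined by its colour and its leaf, and the stars are read off from this
-- N × N grid: when all centres coincide, the edge of colour a whose leaf is numbered p in Fin N goes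
-- to star a + p mod N (a cyclic Latin square); when the centres are distinct, an edge whose leaf is the
-- centre of colour b is turned around into star b, and the edges at the one vertex that is no centre
-- stay in the star of their own colour.
module Submission where

open import Defs
open import Data.Nat using (ℕ; _≤_; _∸_)
open import Data.Fin using (Fin)
open import Data.Sum using (_⊎_)
open import Function.Bundles using (_⇔_)
open import Function.Definitions using (Injective)
open import Relation.Binary.PropositionalEquality using (_≡_)

open import Data.Bool.Properties using (T-≡)
open import Data.Empty using (⊥-elim)
open import Data.Fin using (zero; toℕ; punchIn; punchOut; _≟_)
open import Data.Fin.Properties
  using (any?; toℕ<n; toℕ-fromℕ<; toℕ-injective; <⇒notInjective; punchIn-injective; punchInᵢ≢i;
         punchOut-injective; punchOut-cong)
open import Data.Fin.Subset using (Subset; _∈_)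
open import Data.Nat using (suc; z≤n; s≤s; _+_; _%_; NonZero)
open import Data.Nat.DivMod using (_mod_; %-distribˡ-+; m%n%n≡m%n; %-congˡ; [m+n]%n≡m%n; m<n⇒m%n≡m)
open import Data.Nat.Properties using (+-comm; +-assoc; m+[n∸m]≡n; <⇒≤; ≤-refl)
open import Data.Product using (∃; ∃₂; _×_; _,_; proj₁; proj₂)
open import Data.Sum using (inj₁; inj₂)
open import Data.Vec using (tabulate)
open import Data.Vec.Properties using (lookup∘tabulate; []=⇒lookup; lookup⇒[]=)
open import Function using (_∘_)
open import Function.Bundles using (mk⇔; Equivalence)
open import Function.Properties.Equivalence using () renaming (sym to ⇔-sym)
open import Relation.Binary.PropositionalEquality using (_≢_; refl; sym; trans; cong; cong₂; subst; module ≡-Reasoning)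
open import Relation.Nullary using (yes; no; does; ¬?; contradiction)
open import Relation.Nullary.Decidable using (_×-dec_; toWitness; isYes≗does; dec-true; decidable-stable)

open Equivalence using (to; from)

injective⇒surjective : ∀ {n} {f : Fin n → Fin n} → Injective _≡_ _≡_ f → ∀ a → ∃ λ p → f p ≡ a
injective⇒surjective {suc n} {f} f-injective a with any? (λ p → f p ≟ a)
... | yes hit = hit
... | no miss = ⊥-elim (<⇒notInjective ≤-refl g-injective)
  where
    a≢f : ∀ p → a ≢ f p
    a≢f p a≡fp = miss (p , sym a≡fp)

    g-injective : Injective _≡_ _≡_ (λ p → punchOut (a≢f p))
    g-injective {p} {q} gp≡gq = f-injective (punchOut-injective (a≢f p) (a≢f q) gp≡gq)

injective-missesAtMostOne : ∀ {n} {f : Fin n → Fin (suc n)} → Injective _≡_ _≡_ f →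
                            ∀ {u v} → (∀ p → f p ≢ u) → (∀ p → f p ≢ v) → u ≡ v
injective-missesAtMostOne {f = f} f-injective {u} {v} misses-u misses-v =
  decidable-stable (u ≟ v) λ u≢v →
    let (p , gp≡v) = injective⇒surjective g-injective (punchOut u≢v)
    in  misses-v p (punchOut-injective _ u≢v gp≡v)
  where
    u≢f : ∀ p → u ≢ f p
    u≢f p = misses-u p ∘ sym

    g-injective : Injective _≡_ _≡_ (λ p → punchOut (u≢f p))
    g-injective {p} {q} gp≡gq = f-injective (punchOut-injective (u≢f p) (u≢f q) gp≡gq)

injective⊎collision : ∀ {m n} (f : Fin m → Fin n) →
                      Injective _≡_ _≡_ f ⊎ ∃₂ λ i j → i ≢ j × f i ≡ f j
injective⊎collision f with any? (λ i → any? (λ j → ¬? (i ≟ j) ×-dec (f i ≟ f j)))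
... | yes (i , j , collision) = inj₂ (i , j , collision)
... | no noCollision = inj₁ λ {i} {j} fi≡fj →
        decidable-stable (i ≟ j) λ i≢j → noCollision (i , j , i≢j , fi≡fj)

module _ {d : ℕ} .{{_ : NonZero d}} where

  [m%d+n]%d≡[m+n]%d : ∀ m n → (m % d + n) % d ≡ (m + n) % d
  [m%d+n]%d≡[m+n]%d m n = begin
    (m % d + n) % d           ≡⟨ %-distribˡ-+ (m % d) n d ⟩
    (m % d % d + n % d) % d   ≡⟨ cong (λ r → (r + n % d) % d) (m%n%n≡m%n m d) ⟩
    (m % d + n % d) % d       ≡⟨ %-distribˡ-+ m n d ⟨
    (m + n) % d               ∎
    where open ≡-Reasoning

  %-cancelˡ-+ : ∀ m {n o} → m ≤ d → (m + n) % d ≡ (m + o) % d → n % d ≡ o % d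
  %-cancelˡ-+ m m≤d eq = trans (sym (undo _)) (trans (cong (λ r → (r + (d ∸ m)) % d) eq) (undo _))
    where
      open ≡-Reasoning
      undo : ∀ n → ((m + n) % d + (d ∸ m)) % d ≡ n % d
      undo n = begin
        ((m + n) % d + (d ∸ m)) % d   ≡⟨ [m%d+n]%d≡[m+n]%d (m + n) (d ∸ m) ⟩
        (m + n + (d ∸ m)) % d         ≡⟨ %-congˡ (cong (_+ (d ∸ m)) (+-comm m n)) ⟩
        (n + m + (d ∸ m)) % d         ≡⟨ %-congˡ (+-assoc n m (d ∸ m)) ⟩
        (n + (m + (d ∸ m))) % d       ≡⟨ %-congˡ (cong (n +_) (m+[n∸m]≡n m≤d)) ⟩
        (n + d) % d                   ≡⟨ [m+n]%n≡m%n n d ⟩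
        n % d                         ∎

module _ {N : ℕ} .{{_ : NonZero N}} where

  infixl 6 _⊕_

  _⊕_ : Fin N → Fin N → Fin N
  a ⊕ b = (toℕ a + toℕ b) mod N

  toℕ-⊕ : ∀ a b → toℕ (a ⊕ b) ≡ (toℕ a + toℕ b) % N
  toℕ-⊕ a b = toℕ-fromℕ< _

  ⊕-comm : ∀ a b → a ⊕ b ≡ b ⊕ a
  ⊕-comm a b = cong (_mod N) (+-comm (toℕ a) (toℕ b))

  ⊕-cancelˡ : ∀ {a b b′} → a ⊕ b ≡ a ⊕ b′ → b ≡ b′
  ⊕-cancelˡ {a} {b} {b′} eq = toℕ-injective (begin
    toℕ b         ≡⟨ m<n⇒m%n≡m (toℕ<n b) ⟨
    toℕ b % N     ≡⟨ %-cancelˡ-+ (toℕ a) (<⇒≤ (toℕ<n a))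
                       (trans (sym (toℕ-⊕ a b)) (trans (cong toℕ eq) (toℕ-⊕ a b′))) ⟩
    toℕ b′ % N    ≡⟨ m<n⇒m%n≡m (toℕ<n b′) ⟩
    toℕ b′        ∎)
    where open ≡-Reasoning

  ⊕-cancelʳ : ∀ {a a′ b} → a ⊕ b ≡ a′ ⊕ b → a ≡ a′
  ⊕-cancelʳ {a} {a′} {b} eq = ⊕-cancelˡ (trans (⊕-comm b a) (trans eq (⊕-comm a′ b)))

fibre : ∀ {m N} → (Fin m → Fin N) → Fin N → Subset m
fibre s k = tabulate λ e → does (s e ≟ k)

∈-fibre⇔ : ∀ {m N} {s : Fin m → Fin N} {k e} → e ∈ fibre s k ⇔ s e ≡ k
∈-fibre⇔ {s = s} {k} {e} = mk⇔
  (λ e∈ → toWitness {a? = s e ≟ k}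
    (from T-≡ (trans (isYes≗does _) (trans (sym (lookup∘tabulate _ e)) ([]=⇒lookup e∈)))))
  (λ se≡k → lookup⇒[]= e _ (trans (lookup∘tabulate _ e) (dec-true (s e ≟ k) se≡k)))

module _ {n : ℕ} (G : Multigraph n) where

  opposite : Fin (m G) → Fin n → Fin n
  opposite e z with proj₁ (ends G e) ≟ z
  ... | yes _ = proj₂ (ends G e)
  ... | no _  = proj₁ (ends G e)

  opposite-incident : ∀ e z → Incident G e (opposite e z)
  opposite-incident e z with proj₁ (ends G e) ≟ z
  ... | yes _ = inj₂ refl
  ... | no _  = inj₁ refl

  module _ {e : Fin (m G)} {z : Fin n} where

    joinsCenter⇒incident : JoinsCenter G e z → Incident G e z
    joinsCenter⇒incident (inj₁ (p , _)) = inj₁ p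
    joinsCenter⇒incident (inj₂ (p , _)) = inj₂ p

    opposite≢ : JoinsCenter G e z → opposite e z ≢ z
    opposite≢ joins with proj₁ (ends G e) ≟ z | joins
    ... | yes _   | inj₁ (_ , q≢z) = q≢z
    ... | yes p≡z | inj₂ (_ , p≢z) = contradiction p≡z p≢z
    ... | no p≢z  | _              = p≢z

    incident⇒≡opposite : ∀ {v} → JoinsCenter G e z → Incident G e v → v ≢ z → v ≡ opposite e z
    incident⇒≡opposite joins inc v≢z with proj₁ (ends G e) ≟ z | inc | joins
    ... | yes p≡z | inj₁ p≡v | _              = contradiction (trans (sym p≡v) p≡z) v≢z
    ... | yes _   | inj₂ q≡v | _              = sym q≡v
    ... | no _    | inj₁ p≡v | _              = sym p≡v
    ... | no p≢z  | inj₂ _   | inj₁ (p≡z , _) = contradiction p≡z p≢z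
    ... | no _    | inj₂ q≡v | inj₂ (q≡z , _) = contradiction (trans (sym q≡v) q≡z) v≢z

    joinsCenter-opposite : JoinsCenter G e z → JoinsCenter G e (opposite e z)
    joinsCenter-opposite joins with opposite e z | opposite-incident e z | opposite≢ joins | joins
    ... | w | inj₁ p≡w | w≢z | inj₁ (p≡z , _) = contradiction (trans (sym p≡w) p≡z) w≢z
    ... | w | inj₁ p≡w | w≢z | inj₂ (q≡z , _) = inj₁ (p≡w , λ q≡w → w≢z (trans (sym q≡w) q≡z))
    ... | w | inj₂ q≡w | w≢z | inj₁ (p≡z , _) = inj₂ (q≡w , λ p≡w → w≢z (trans (sym p≡w) p≡z))
    ... | w | inj₂ q≡w | w≢z | inj₂ (q≡z , _) = contradiction (trans (sym q≡w) q≡z) w≢z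

  opposite-involutive : ∀ {e z} → JoinsCenter G e z → opposite e (opposite e z) ≡ z
  opposite-involutive joins = sym (incident⇒≡opposite (joinsCenter-opposite joins)
    (joinsCenter⇒incident joins) (opposite≢ joins ∘ sym))

  module _ {S : Fin (m G) → Set} {z : Fin n} where

    spanningStar-unique : IsSpanningStarAt G S z → ∀ {v e e′} → v ≢ z → S e → S e′ →
                          Incident G e v → Incident G e′ v → e ≡ e′
    spanningStar-unique (_ , cover) v≢z = proj₂ (cover _ v≢z) _ _

    spanningStar⇒opposite-surjective : IsSpanningStarAt G S z →
                                       ∀ v → v ≢ z → ∃ λ e → S e × opposite e z ≡ v
    spanningStar⇒opposite-surjective star@(joins , cover) v v≢z
      with e , Se , inc ← proj₁ (cover v v≢z)
      = e , Se , sym (incident⇒≡opposite (joins e Se) inc v≢z)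

    spanningStar⇒opposite-injective : IsSpanningStarAt G S z → ∀ {e e′} → S e → S e′ →
                                      opposite e z ≡ opposite e′ z → e ≡ e′
    spanningStar⇒opposite-injective star@(joins , _) {e} {e′} Se Se′ same =
      spanningStar-unique star (opposite≢ (joins e Se)) Se Se′
        (opposite-incident e z) (subst (Incident G e′) (sym same) (opposite-incident e′ z))

    spanningStar-intro : (∀ e → S e → JoinsCenter G e z) →
                         (∀ v → v ≢ z → ∃ λ e → S e × opposite e z ≡ v) →
                         (∀ {e e′} → S e → S e′ → opposite e z ≡ opposite e′ z → e ≡ e′) →
                         IsSpanningStarAt G S z
    spanningStar-intro joins onto opposite-injective = joins , λ v v≢z →
      (let e , Se , opp≡v = onto v v≢z in e , Se , subst (Incident G e) opp≡v (opposite-incident e z)) ,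
      λ e e′ Se Se′ inc inc′ → opposite-injective Se Se′
        (trans (sym (incident⇒≡opposite (joins e Se) inc v≢z)) (incident⇒≡opposite (joins e′ Se′) inc′ v≢z))

  spanningStar-resp : ∀ {S S′ z} → (∀ {e} → S e ⇔ S′ e) → IsSpanningStarAt G S z → IsSpanningStarAt G S′ z
  spanningStar-resp S⇔S′ star@(joins , _) = spanningStar-intro
    (λ e → joins e ∘ from S⇔S′)
    (λ v v≢z → let e , Se , opp≡v = spanningStar⇒opposite-surjective star v v≢z in e , to S⇔S′ Se , opp≡v)
    (λ Se Se′ → spanningStar⇒opposite-injective star (from S⇔S′ Se) (from S⇔S′ Se′))

module _ {N : ℕ} (G : Multigraph (suc N)) (col : Fin (m G) → Fin N) where

  rainbowStar-hasColour : ∀ {S} → RainbowSpanningStar G col S → ∀ a → ∃ λ e → e ∈ S × col e ≡ a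
  rainbowStar-hasColour {S} ((x , star) , rainbow) a =
    let p , colour≡a = injective⇒surjective colourAt-injective a
    in  proj₁ (reach p) , proj₁ (proj₂ (reach p)) , colour≡a
    where
      reach : ∀ p → ∃ λ e → e ∈ S × opposite G e x ≡ punchIn x p
      reach p = spanningStar⇒opposite-surjective G star (punchIn x p) (punchInᵢ≢i x p)

      colourAt : Fin N → Fin N
      colourAt p = col (proj₁ (reach p))

      colourAt-injective : Injective _≡_ _≡_ colourAt
      colourAt-injective {p} {q} same = punchIn-injective x p q (begin
        punchIn x p                     ≡⟨ proj₂ (proj₂ (reach p)) ⟨
        opposite G (proj₁ (reach p)) x  ≡⟨ cong (λ e → opposite G e x) edges-equal ⟩
        opposite G (proj₁ (reach q)) x  ≡⟨ proj₂ (proj₂ (reach q)) ⟩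
        punchIn x q                     ∎)
        where
          open ≡-Reasoning
          edges-equal = rainbow _ _ (proj₁ (proj₂ (reach p))) (proj₁ (proj₂ (reach q))) same

  partition⇒disjointRainbowStars :
    (s : Fin (m G) → Fin N) (z : Fin N → Fin (suc N)) →
    (∀ k → IsSpanningStarAt G (λ e → s e ≡ k) (z k)) →
    (∀ {e e′} → s e ≡ s e′ → col e ≡ col e′ → e ≡ e′) →
    HasDisjointRainbowStars G col
  partition⇒disjointRainbowStars s z star rainbow =
    fibre s ,
    (λ k → (z k , spanningStar-resp G (⇔-sym (member k)) (star k)) ,
           λ e e′ e∈ e′∈ → rainbow (trans (to (member k) e∈) (sym (to (member k) e′∈)))) ,
    λ i j i≢j e e∈i e∈j → i≢j (trans (sym (to (member i) e∈i)) (to (member j) e∈j))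
    where
      member : ∀ k {e} → e ∈ fibre s k ⇔ s e ≡ k
      member k = ∈-fibre⇔ {s = s}

  module StarColouring (c : Fin N → Fin (suc N))
                       (colourStar : ∀ i → IsSpanningStarAt G (ColorClass G col i) (c i)) where

    centred : ∀ e → JoinsCenter G e (c (col e))
    centred e = proj₁ (colourStar (col e)) e refl

    leaf : Fin (m G) → Fin (suc N)
    leaf e = opposite G e (c (col e))

    leaf≢centre : ∀ e → leaf e ≢ c (col e)
    leaf≢centre e = opposite≢ G (centred e)

    incident⇒≡leaf : ∀ {e v} → Incident G e v → v ≢ c (col e) → v ≡ leaf e
    incident⇒≡leaf {e} = incident⇒≡opposite G (centred e)

    edgeWith : ∀ {a v} → v ≢ c a → ∃ λ e → col e ≡ a × leaf e ≡ v
    edgeWith {a} {v} v≢ca with e , refl , opp≡v ← spanningStar⇒opposite-surjective G (colourStar a) v v≢ca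
      = e , refl , opp≡v

    leaf-injective : ∀ {e e′} → col e ≡ col e′ → leaf e ≡ leaf e′ → e ≡ e′
    leaf-injective {e} {e′} same-col same-leaf =
      spanningStar⇒opposite-injective G (colourStar (col e)) refl (sym same-col)
        (trans same-leaf (cong (λ a → opposite G e′ (c a)) (sym same-col)))

    incident-centre : ∀ {e u} → c (col e) ≡ u → Incident G e u
    incident-centre {e} refl = joinsCenter⇒incident G (centred e)

    collision⇒centre : ∀ {i i′ S x} → i ≢ i′ → c i ≡ c i′ →
                       IsSpanningStarAt G (_∈ S) x → Rainbow G col S → x ≡ c i
    collision⇒centre {i} {i′} {S} {x} i≢i′ ci≡ci′ star rainbow
      with e , e∈S , col-e ← rainbowStar-hasColour ((x , star) , rainbow) i
         | e′ , e′∈S , col-e′ ← rainbowStar-hasColour ((x , star) , rainbow) i′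
      = decidable-stable (x ≟ c i) λ x≢ci →
          i≢i′ (trans (sym col-e) (trans (cong col (e≡e′ x≢ci)) col-e′))
      where
        e≡e′ : x ≢ c i → e ≡ e′
        e≡e′ x≢ci = spanningStar-unique G star (x≢ci ∘ sym) e∈S e′∈S
          (incident-centre (cong c col-e)) (incident-centre (trans (cong c col-e′) (sym ci≡ci′)))

    collision⇒constant : HasDisjointRainbowStars G col → ∀ {i i′} → i ≢ i′ → c i ≡ c i′ →
                         ∀ j → c j ≡ c i
    collision⇒constant (T , rainbowStars , disjoint) {i} {i′} i≢i′ ci≡ci′ j
      with f , f∈Ti , col-f ← rainbowStar-hasColour (rainbowStars i) j
         | f′ , f′∈Ti′ , col-f′ ← rainbowStar-hasColour (rainbowStars i′) j
      = decidable-stable (c j ≟ c i) λ cj≢ci →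
          disjoint i i′ i≢i′ f f∈Ti (subst (_∈ T i′) (sym (f≡f′ cj≢ci)) f′∈Ti′)
      where
        centre-is-leaf : ∀ {t g} → g ∈ T t → col g ≡ j → c j ≢ c i → c i ≡ leaf g
        centre-is-leaf {t} {g} g∈Tt col-g cj≢ci
          with (x , star) , rainbow ← rainbowStars t
          = incident⇒≡leaf
              (subst (Incident G g) (collision⇒centre i≢i′ ci≡ci′ star rainbow)
                (joinsCenter⇒incident G (proj₁ star g g∈Tt)))
              (λ ci≡cg → cj≢ci (trans (cong c (sym col-g)) (sym ci≡cg)))

        f≡f′ : c j ≢ c i → f ≡ f′
        f≡f′ cj≢ci = leaf-injective (trans col-f (sym col-f′))
          (trans (sym (centre-is-leaf f∈Ti col-f cj≢ci)) (centre-is-leaf f′∈Ti′ col-f′ cj≢ci))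

    module SameCentre (z : Fin (suc N)) (centre≡z : ∀ a → c a ≡ z) .{{_ : NonZero N}} where

      z≢leaf : ∀ e → z ≢ leaf e
      z≢leaf e z≡leaf = leaf≢centre e (trans (sym z≡leaf) (sym (centre≡z (col e))))

      position : Fin (m G) → Fin N
      position e = punchOut (z≢leaf e)

      host : Fin (m G) → Fin N
      host e = col e ⊕ position e

      opposite≡leaf : ∀ e → opposite G e z ≡ leaf e
      opposite≡leaf e = cong (opposite G e) (sym (centre≡z (col e)))

      star : ∀ k → IsSpanningStarAt G (λ e → host e ≡ k) z
      star k = spanningStar-intro G (λ e _ → subst (JoinsCenter G e) (centre≡z (col e)) (centred e)) onto inj
        where
          onto : ∀ v → v ≢ z → ∃ λ e → host e ≡ k × opposite G e z ≡ v
          onto v v≢z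
            with a , a⊕q≡k ← injective⇒surjective (⊕-cancelʳ {b = punchOut (v≢z ∘ sym)}) k
            with e , col-e , leaf≡v ← edgeWith {a} {v} (v≢z ∘ λ v≡ca → trans v≡ca (centre≡z a))
            = e , trans (cong₂ _⊕_ col-e (punchOut-cong z leaf≡v)) a⊕q≡k , trans (opposite≡leaf e) leaf≡v

          inj : ∀ {e e′} → host e ≡ k → host e′ ≡ k → opposite G e z ≡ opposite G e′ z → e ≡ e′
          inj {e} {e′} se≡k se′≡k same = leaf-injective
            (⊕-cancelʳ (trans (trans se≡k (sym se′≡k)) (cong (col e′ ⊕_) (punchOut-cong z (sym same-leaf)))))
            same-leaf
            where
              same-leaf : leaf e ≡ leaf e′
              same-leaf = trans (sym (opposite≡leaf e)) (trans same (opposite≡leaf e′))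

      rainbow : ∀ {e e′} → host e ≡ host e′ → col e ≡ col e′ → e ≡ e′
      rainbow {e} {e′} same same-col = leaf-injective same-col
        (punchOut-injective (z≢leaf e) (z≢leaf e′) (⊕-cancelˡ (trans same (cong (_⊕ position e′) (sym same-col)))))

      disjointRainbowStars : HasDisjointRainbowStars G col
      disjointRainbowStars = partition⇒disjointRainbowStars host (λ _ → z) star rainbow

    module DistinctCentres (c-injective : Injective _≡_ _≡_ c) where

      NonCentre : Fin (suc N) → Set
      NonCentre v = ∀ b → c b ≢ v

      host : Fin (m G) → Fin N
      host e with any? (λ b → c b ≟ leaf e)
      ... | yes (b , _) = b
      ... | no _        = col e

      host-centre : ∀ {e k} → c k ≡ leaf e → host e ≡ k
      host-centre {e} {k} ck≡leaf with any? (λ b → c b ≟ leaf e)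
      ... | yes (b , cb≡leaf) = c-injective (trans cb≡leaf (sym ck≡leaf))
      ... | no noCentre       = contradiction (k , ck≡leaf) noCentre

      host-nonCentre : ∀ {e} → NonCentre (leaf e) → host e ≡ col e
      host-nonCentre {e} nonCentre with any? (λ b → c b ≟ leaf e)
      ... | yes (b , cb≡leaf) = contradiction cb≡leaf (nonCentre b)
      ... | no _              = refl

      host-cases : ∀ {e k} → host e ≡ k → c k ≡ leaf e ⊎ (col e ≡ k × NonCentre (leaf e))
      host-cases {e} refl with any? (λ b → c b ≟ leaf e)
      ... | yes (b , cb≡leaf) = inj₁ cb≡leaf
      ... | no noCentre       = inj₂ (refl , λ b cb≡leaf → noCentre (b , cb≡leaf))

      star : ∀ k → IsSpanningStarAt G (λ e → host e ≡ k) (c k)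
      star k = spanningStar-intro G joins onto inj
        where
          opposite-turned : ∀ {e} → c k ≡ leaf e → opposite G e (c k) ≡ c (col e)
          opposite-turned {e} ck≡leaf = trans (cong (opposite G e) ck≡leaf) (opposite-involutive G (centred e))

          opposite-own : ∀ {e} → col e ≡ k → opposite G e (c k) ≡ leaf e
          opposite-own {e} col-e = cong (λ a → opposite G e (c a)) (sym col-e)

          joins : ∀ e → host e ≡ k → JoinsCenter G e (c k)
          joins e host≡k with host-cases host≡k
          ... | inj₁ ck≡leaf       = subst (JoinsCenter G e) (sym ck≡leaf) (joinsCenter-opposite G (centred e))
          ... | inj₂ (col-e , _)   = subst (λ a → JoinsCenter G e (c a)) col-e (centred e)

          onto : ∀ v → v ≢ c k → ∃ λ e → host e ≡ k × opposite G e (c k) ≡ v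
          onto v v≢ck with any? (λ b → c b ≟ v)
          ... | yes (b , cb≡v)
            with e , col-e , leaf≡ck ← edgeWith {b} {c k} (λ ck≡cb → v≢ck (trans (sym cb≡v) (sym ck≡cb)))
            = e , host-centre (sym leaf≡ck) , trans (opposite-turned (sym leaf≡ck)) (trans (cong c col-e) cb≡v)
          onto v v≢ck | no noCentre
            with e , col-e , leaf≡v ← edgeWith {k} {v} v≢ck
            = e , trans (host-nonCentre (λ b cb≡leaf → noCentre (b , trans cb≡leaf leaf≡v))) col-e
                , trans (opposite-own col-e) leaf≡v

          inj : ∀ {e e′} → host e ≡ k → host e′ ≡ k → opposite G e (c k) ≡ opposite G e′ (c k) → e ≡ e′
          inj {e} {e′} host≡k host′≡k same with host-cases host≡k | host-cases host′≡k
          ... | inj₁ ck≡leaf | inj₁ ck≡leaf′ =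
            leaf-injective (c-injective (trans (sym (opposite-turned ck≡leaf)) (trans same (opposite-turned ck≡leaf′))))
                           (trans (sym ck≡leaf) ck≡leaf′)
          ... | inj₂ (col-e , _) | inj₂ (col-e′ , _) =
            leaf-injective (trans col-e (sym col-e′))
                           (trans (sym (opposite-own col-e)) (trans same (opposite-own col-e′)))
          ... | inj₁ ck≡leaf | inj₂ (col-e′ , nonCentre′) =
            contradiction (trans (sym (opposite-turned ck≡leaf)) (trans same (opposite-own col-e′))) (nonCentre′ (col e))
          ... | inj₂ (col-e , nonCentre) | inj₁ ck≡leaf′ =
            contradiction (trans (sym (opposite-turned ck≡leaf′)) (trans (sym same) (opposite-own col-e))) (nonCentre (col e′))

      rainbow : ∀ {e e′} → host e ≡ host e′ → col e ≡ col e′ → e ≡ e′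
      rainbow {e} {e′} same same-col with host-cases {e} refl | host-cases (sym same)
      ... | inj₁ ck≡leaf | inj₁ ck≡leaf′ = leaf-injective same-col (trans (sym ck≡leaf) ck≡leaf′)
      ... | inj₂ (_ , nonCentre) | inj₂ (_ , nonCentre′) =
        leaf-injective same-col (injective-missesAtMostOne c-injective nonCentre nonCentre′)
      ... | inj₁ ck≡leaf | inj₂ (col-e′ , _) =
        contradiction (trans (sym ck≡leaf) (cong c (sym (trans same-col col-e′)))) (leaf≢centre e)
      ... | inj₂ (col-e , _) | inj₁ ck≡leaf′ =
        contradiction (trans (sym ck≡leaf′) (cong c (sym (trans (sym same-col) col-e)))) (leaf≢centre e′)

      disjointRainbowStars : HasDisjointRainbowStars G col
      disjointRainbowStars = partition⇒disjointRainbowStars host c star rainbow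

theorem3p8 : (n : ℕ) → 2 ≤ n → (G : Multigraph n) →
    (col : Fin (m G) → Fin (n ∸ 1)) →
    (c : Fin (n ∸ 1) → Fin n) →
    (∀ i → IsSpanningStarAt G (ColorClass G col i) (c i)) →
    (HasDisjointRainbowStars G col ⇔
      ((∀ i j → c i ≡ c j) ⊎ Injective _≡_ _≡_ c))
theorem3p8 (suc (suc K)) (s≤s (s≤s z≤n)) G col c colourStar = mk⇔ necessary sufficient
  where
    open StarColouring G col c colourStar

    necessary : HasDisjointRainbowStars G col → (∀ i j → c i ≡ c j) ⊎ Injective _≡_ _≡_ c
    necessary stars with injective⊎collision c
    ... | inj₁ c-injective = inj₂ c-injective
    ... | inj₂ (i , i′ , i≢i′ , ci≡ci′) = inj₁ λ a b →
            trans (collision⇒constant stars i≢i′ ci≡ci′ a) (sym (collision⇒constant stars i≢i′ ci≡ci′ b))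

    sufficient : (∀ i j → c i ≡ c j) ⊎ Injective _≡_ _≡_ c → HasDisjointRainbowStars G col
    sufficient (inj₁ constant)    = SameCentre.disjointRainbowStars (c zero) (λ a → constant a zero)
    sufficient (inj₂ c-injective) = DistinctCentres.disjointRainbowStars c-injective
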